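{- Let $q$ be a prime power, let $Y \subseteq \mathbb{F}_q\setminus\{0\}$, $C\subseteq\mathbb{F}_q$, and $E = C\times C$. Then there exists $y\in Y$ such that \[ |\{ay+b : (a,b)\in E\}| \gg \min\left\{ q,\ \frac{|Y|\,|E|}{q} \right\}. \]
   Context: $\mathbb{F}_q$ is the finite field with $q$ elements. The notation $f\gg g$ means $f\ge cg$ for an absolute constant $c>0$ not depending on any other parameters. -}

module Defs where

open import Data.Nat using (ℕ; _≤_; _^_)
open import Data.Nat.Primality using (Prime)
open import Data.Fin using (Fin)
open import Data.Fin.Subset using (Subset; ⋃; ⁅_⁆)
open import Data.List using (List; filterᵇ; allFin; concatMap; map)
open import Data.Vec using (lookup)
open import Data.Product using (Σ; ∃; _×_)
open import Relation.Binary.PropositionalEquality using (_≡_; _≢_)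
open import Algebra.Structures using (IsCommutativeRing)

IsPrimePower : ℕ → Set
IsPrimePower q = Σ ℕ λ p → Σ ℕ λ k → Prime p × 1 ≤ k × q ≡ p ^ k

record FiniteField (q : ℕ) : Set where
  infixl 7 _*_
  infixl 6 _+_
  field
    _+_ _*_ : Fin q → Fin q → Fin q
    -_      : Fin q → Fin q
    0# 1#   : Fin q
    isCommutativeRing : IsCommutativeRing _≡_ _+_ _*_ -_ 0# 1#
    0≢1     : 0# ≢ 1#
    inverse : ∀ x → x ≢ 0# → ∃ λ y → x * y ≡ 1#

elems : {q : ℕ} → Subset q → List (Fin q)
elems {q} C = filterᵇ (lookup C) (allFin q)

lineImage : {q : ℕ} → FiniteField q → Subset q → Fin q → Subset q
lineImage F C y =
  ⋃ (concatMap (λ a → map (λ b → ⁅ a * y + b ⁆) (elems C)) (elems C))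
  where open FiniteField F

{-# OPTIONS --safe #-}
module Submission where

-- For y ∈ 𝔽_q let r_y(x) be the number of (a , b) ∈ C × C with a y + b = x, and let
-- E(y) = Σₓ r_y(x)² count the pairs of these lines that meet above y. Cauchy–Schwarz on the
-- support of r_y gives |C|⁴ ≤ |L_y| E(y) ≤ q E(y), where L_y is the line image. Two distinct
-- lines meet at most once, so Σ_y E(y) ≤ q |C|² + |C|⁴; removing the y ∉ Y, each worth at
-- least |C|⁴, leaves Σ_{y ∈ Y} q E(y) ≤ |Y| |C|⁴ + q² |C|². A y ∈ Y that is at most average
-- then satisfies q |Y| |C|² ≤ |L_y| (|Y| |C|² + q²), hence min(q², |Y| |C|²) ≤ 2 q |L_y|.

open import Defs
open import Data.Nat using (ℕ; _≤_; _*_; _⊓_)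
open import Data.Fin.Subset using (Subset; _∈_; _∉_; Nonempty; ∣_∣)
open import Data.Product using (Σ; ∃; _×_)

open import Data.Nat using (zero; suc; _+_; _<_; z≤n; s≤s; _≤?_; >-nonZero)
open import Data.Nat.Properties
  using ( +-*-semiring; *-assoc; +-mono-≤; +-monoˡ-≤; +-monoʳ-≤; *-monoˡ-≤; *-monoʳ-≤
        ; +-cancelʳ-≤; *-cancelˡ-≤; *-cancelʳ-≤
        ; *-identityˡ; *-identityʳ; +-identityʳ; *-zeroʳ; ≤-reflexive; ≤-trans; ≤-total; m≤m+n
        ; m≤n⇒∃[o]m+o≡n; m⊓n≤m; m⊓n≤n; ⊓-zeroʳ; ≰⇒>; n≮n; module ≤-Reasoning)
open import Data.Nat.Tactic.RingSolver using (solve-∀)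
open import Data.Fin using (Fin; zero; suc; _≟_)
open import Data.Fin.Properties using (0≢1+n; suc-injective; any?)
open import Data.Fin.Subset using (⁅_⁆; ⋃)
open import Data.Fin.Subset.Properties
  using (_∈?_; ∣p∣≤n; ∣⁅x⁆∣≡1; p⊆q⇒∣p∣≤∣q∣; x∈⁅x⁆; x∈⁅y⁆⇒x≡y; x∈p∪q⁺)
open import Data.Product using (_,_)
open import Data.Sum using (inj₁; inj₂)
open import Data.Unit using (tt)
open import Data.Bool using (true; false; T; if_then_else_)
open import Data.Vec using (_∷_; []; lookup)
open import Data.Vec.Properties using ([]=⇒lookup)
open import Data.List using (List; map)
open import Data.List.Relation.Unary.Any using (here; there)
open import Data.List.Membership.Propositional using (lose) renaming (_∈_ to _∈ₗ_)
open import Data.List.Membership.Propositional.Properties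
  using (∈-filter⁺; ∈-allFin; ∈-map⁺; ∈-concatMap⁺)
open import Function using (_∘_)
open import Relation.Nullary using (Dec; yes; no; ¬_; does; contradiction)
open import Relation.Nullary.Decidable using (_×-dec_; T?)
open import Relation.Binary.PropositionalEquality
  using (_≡_; _≢_; refl; sym; trans; cong; cong₂; subst; subst₂; module ≡-Reasoning)
open import Algebra.Bundles using (CommutativeRing)
import Algebra.Properties.Ring as RingProperties
open import Algebra.Properties.Semiring.Sum +-*-semiring
  using (sum; sum-syntax; sum-cong-≗; sum-replicate-zero; ∑-comm; ∑-distrib-+; *-distribˡ-sum; *-distribʳ-sum)

⟦_⟧ : {P : Set} → Dec P → ℕ
⟦ d ⟧ = if does d then 1 else 0

⟦⟧-yes : {P : Set} (d : Dec P) → P → ⟦ d ⟧ ≡ 1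
⟦⟧-yes (yes _) _ = refl
⟦⟧-yes (no ¬p) p = contradiction p ¬p

⟦⟧-no : {P : Set} (d : Dec P) → ¬ P → ⟦ d ⟧ ≡ 0
⟦⟧-no (yes p) ¬p = contradiction p ¬p
⟦⟧-no (no _) _ = refl

⟦⟧-idem : {P : Set} (d : Dec P) → ⟦ d ⟧ * ⟦ d ⟧ ≡ ⟦ d ⟧
⟦⟧-idem (yes _) = refl
⟦⟧-idem (no _) = refl

χ : ∀ {n} → Subset n → Fin n → ℕ
χ p x = ⟦ x ∈? p ⟧

∈-elems : ∀ {n} {x : Fin n} {p : Subset n} → x ∈ p → x ∈ₗ elems p
∈-elems {x = x} {p} x∈p = ∈-filter⁺ (T? ∘ lookup p) (∈-allFin x) (subst T (sym ([]=⇒lookup x∈p)) tt)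

∈-⋃ : ∀ {n} {x : Fin n} {s : Subset n} {ss : List (Subset n)} → s ∈ₗ ss → x ∈ s → x ∈ ⋃ ss
∈-⋃ (here refl) x∈s = x∈p∪q⁺ (inj₁ x∈s)
∈-⋃ (there s∈ss) x∈s = x∈p∪q⁺ (inj₂ (∈-⋃ s∈ss x∈s))

∣p∣≡∑χ : ∀ {n} (p : Subset n) → ∣ p ∣ ≡ sum (χ p)
∣p∣≡∑χ [] = refl
∣p∣≡∑χ (true ∷ p) = cong suc (∣p∣≡∑χ p)
∣p∣≡∑χ (false ∷ p) = ∣p∣≡∑χ p

∑-mono-≤ : ∀ {n} {f g : Fin n → ℕ} → (∀ i → f i ≤ g i) → sum f ≤ sum g
∑-mono-≤ {zero} _ = z≤n
∑-mono-≤ {suc n} f≤g = +-mono-≤ (f≤g zero) (∑-mono-≤ (f≤g ∘ suc))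

∑-const : ∀ n c → ∑[ i < n ] c ≡ n * c
∑-const zero c = refl
∑-const (suc n) c = cong (c +_) (∑-const n c)

∑-zero : ∀ {n} {f : Fin n → ℕ} → (∀ i → f i ≡ 0) → sum f ≡ 0
∑-zero {n} f≡0 = trans (sum-cong-≗ f≡0) (sum-replicate-zero n)

∑-select : ∀ {n} (t : Fin n) (f : Fin n → ℕ) → ∑[ x < n ] (⟦ t ≟ x ⟧ * f x) ≡ f t
∑-select {suc n} zero f = trans (cong₂ _+_ (*-identityˡ (f zero)) (sum-replicate-zero n)) (+-identityʳ (f zero))
∑-select (suc t) f = ∑-select t (f ∘ suc)

∑⟦P⟧≤1 : ∀ {n} {P : Fin n → Set} (P? : ∀ x → Dec (P x)) →
              (∀ {x y} → P x → P y → x ≡ y) → ∑[ x < n ] ⟦ P? x ⟧ ≤ 1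
∑⟦P⟧≤1 {zero} P? unique = z≤n
∑⟦P⟧≤1 {suc n} P? unique with P? zero
... | yes P₀ = s≤s (≤-reflexive (∑-zero (λ x → ⟦⟧-no (P? (suc x)) (0≢1+n ∘ unique P₀))))
... | no _ = ∑⟦P⟧≤1 (P? ∘ suc) (λ Px Py → suc-injective (unique Px Py))

∑₂ : ∀ {m n} → (Fin m → Fin n → ℕ) → ℕ
∑₂ {m} {n} f = ∑[ i < m ] ∑[ j < n ] f i j

∑₂-cong : ∀ {m n} {f g : Fin m → Fin n → ℕ} → (∀ i j → f i j ≡ g i j) → ∑₂ f ≡ ∑₂ g
∑₂-cong f≡g = sum-cong-≗ (λ i → sum-cong-≗ (f≡g i))

∑₂-mono-≤ : ∀ {m n} {f g : Fin m → Fin n → ℕ} → (∀ i j → f i j ≤ g i j) → ∑₂ f ≤ ∑₂ g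
∑₂-mono-≤ f≤g = ∑-mono-≤ (λ i → ∑-mono-≤ (f≤g i))

*-distribʳ-∑₂ : ∀ {m n} c (f : Fin m → Fin n → ℕ) → ∑₂ f * c ≡ ∑₂ (λ i j → f i j * c)
*-distribʳ-∑₂ {n = n} c f =
  trans (*-distribʳ-sum c (λ i → ∑[ j < n ] f i j)) (sum-cong-≗ (λ i → *-distribʳ-sum c (f i)))

∑₂-distrib-+ : ∀ {m n} (f g : Fin m → Fin n → ℕ) → ∑₂ (λ i j → f i j + g i j) ≡ ∑₂ f + ∑₂ g
∑₂-distrib-+ {n = n} f g =
  trans (sum-cong-≗ (λ i → ∑-distrib-+ (f i) (g i))) (∑-distrib-+ (λ i → ∑[ j < n ] f i j) (λ i → ∑[ j < n ] g i j))

*-distribˡ-∑₂ : ∀ {m n} c (f : Fin m → Fin n → ℕ) → c * ∑₂ f ≡ ∑₂ (λ i j → c * f i j)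
*-distribˡ-∑₂ {n = n} c f =
  trans (*-distribˡ-sum c (λ i → ∑[ j < n ] f i j)) (sum-cong-≗ (λ i → *-distribˡ-sum c (f i)))

∑-∑₂-comm : ∀ {k m n} (f : Fin k → Fin m → Fin n → ℕ) →
            ∑[ y < k ] ∑₂ (f y) ≡ ∑₂ (λ i j → ∑[ y < k ] f y i j)
∑-∑₂-comm {k} {m} {n} f =
  trans (∑-comm (λ y i → ∑[ j < n ] f y i j)) (sum-cong-≗ (λ i → ∑-comm {k} {n} (λ y → f y i)))

∑*∑≡∑₂ : ∀ {m n} (f : Fin m → ℕ) (g : Fin n → ℕ) → sum f * sum g ≡ ∑₂ (λ i j → f i * g j)
∑*∑≡∑₂ f g = trans (*-distribʳ-sum (sum g) f) (sum-cong-≗ (λ i → *-distribˡ-sum (f i) g))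

∑₂-select : ∀ {m n} (a : Fin m) (b : Fin n) (f : Fin m → Fin n → ℕ) →
            ∑₂ (λ i j → ⟦ a ≟ i ⟧ * (⟦ b ≟ j ⟧ * f i j)) ≡ f a b
∑₂-select {m} {n} a b f = begin
  ∑₂ (λ i j → ⟦ a ≟ i ⟧ * (⟦ b ≟ j ⟧ * f i j))
    ≡⟨ sum-cong-≗ (λ i → *-distribˡ-sum ⟦ a ≟ i ⟧ (λ j → ⟦ b ≟ j ⟧ * f i j)) ⟨
  ∑[ i < m ] (⟦ a ≟ i ⟧ * ∑[ j < n ] (⟦ b ≟ j ⟧ * f i j))
    ≡⟨ sum-cong-≗ (λ i → cong (⟦ a ≟ i ⟧ *_) (∑-select b (f i))) ⟩
  ∑[ i < m ] (⟦ a ≟ i ⟧ * f i b)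
    ≡⟨ ∑-select a (λ i → f i b) ⟩
  f a b ∎
  where open ≡-Reasoning

2mn≤m²+n² : ∀ m n → 2 * (m * n) ≤ m * m + n * n
2mn≤m²+n² m n with ≤-total m n
... | inj₁ m≤n with d , refl ← m≤n⇒∃[o]m+o≡n m≤n =
  ≤-trans (m≤m+n _ (d * d)) (≤-reflexive (square-gap m d))
  where
  square-gap : ∀ m d → 2 * (m * (m + d)) + d * d ≡ m * m + (m + d) * (m + d)
  square-gap = solve-∀
... | inj₂ n≤m with d , refl ← m≤n⇒∃[o]m+o≡n n≤m =
  ≤-trans (m≤m+n _ (d * d)) (≤-reflexive (square-gap n d))
  where
  square-gap : ∀ n d → 2 * ((n + d) * n) + d * d ≡ (n + d) * (n + d) + n * n
  square-gap = solve-∀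

cauchy-schwarz : ∀ {n} (f g : Fin n → ℕ) →
                 ∑[ i < n ] (f i * g i) * ∑[ i < n ] (f i * g i)
                   ≤ ∑[ i < n ] (f i * f i) * ∑[ i < n ] (g i * g i)
cauchy-schwarz {n} f g = *-cancelˡ-≤ 2 (begin
  2 * (sum fg * sum fg)
    ≡⟨ cong (2 *_) (∑*∑≡∑₂ fg fg) ⟩
  2 * ∑₂ (λ i j → fg i * fg j)
    ≡⟨ *-distribˡ-∑₂ 2 (λ i j → fg i * fg j) ⟩
  ∑₂ (λ i j → 2 * (fg i * fg j))
    ≤⟨ ∑₂-mono-≤ (λ i j → cross-term (f i) (g i) (f j) (g j)) ⟩
  ∑₂ (λ i j → ff i * gg j + ff j * gg i)
    ≡⟨ ∑₂-distrib-+ (λ i j → ff i * gg j) (λ i j → ff j * gg i) ⟩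
  ∑₂ (λ i j → ff i * gg j) + ∑₂ (λ i j → ff j * gg i)
    ≡⟨ cong (∑₂ (λ i j → ff i * gg j) +_) (∑-comm (λ i j → ff j * gg i)) ⟩
  ∑₂ (λ i j → ff i * gg j) + ∑₂ (λ i j → ff i * gg j)
    ≡⟨ cong (λ s → s + s) (∑*∑≡∑₂ ff gg) ⟨
  sum ff * sum gg + sum ff * sum gg
    ≡⟨ cong (sum ff * sum gg +_) (+-identityʳ (sum ff * sum gg)) ⟨
  2 * (sum ff * sum gg) ∎)
  where
  open ≤-Reasoning
  fg ff gg : Fin n → ℕ
  fg i = f i * g i
  ff i = f i * f i
  gg i = g i * g i
  cross-term : ∀ a b c d → 2 * (a * b * (c * d)) ≤ a * a * (d * d) + c * c * (b * b)
  cross-term a b c d = begin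
    2 * (a * b * (c * d))                   ≡⟨ regroup a b c d ⟩
    2 * ((a * d) * (c * b))                 ≤⟨ 2mn≤m²+n² (a * d) (c * b) ⟩
    (a * d) * (a * d) + (c * b) * (c * b)   ≡⟨ square-products a b c d ⟩
    a * a * (d * d) + c * c * (b * b)       ∎
    where
    regroup : ∀ a b c d → 2 * (a * b * (c * d)) ≡ 2 * ((a * d) * (c * b))
    regroup = solve-∀
    square-products : ∀ a b c d → (a * d) * (a * d) + (c * b) * (c * b) ≡ a * a * (d * d) + c * c * (b * b)
    square-products = solve-∀

cauchy-schwarz-on-support : ∀ {n} (p : Subset n) (r : Fin n → ℕ) → (∀ x → x ∉ p → r x ≡ 0) →
                            sum r * sum r ≤ ∣ p ∣ * ∑[ x < n ] (r x * r x)
cauchy-schwarz-on-support p r vanishes = subst₂ _≤_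
  (cong₂ _*_ restrict restrict)
  (cong (_* _) (trans (sum-cong-≗ (λ x → ⟦⟧-idem (x ∈? p))) (sym (∣p∣≡∑χ p))))
  (cauchy-schwarz (χ p) r)
  where
  restrict : ∑[ x < _ ] (χ p x * r x) ≡ sum r
  restrict = sum-cong-≗ χr≡r
    where
    χr≡r : ∀ x → χ p x * r x ≡ r x
    χr≡r x with x ∈? p
    ... | yes _ = +-identityʳ (r x)
    ... | no x∉p = sym (vanishes x x∉p)

∣p∣>0 : ∀ {n} {p : Subset n} → Nonempty p → 0 < ∣ p ∣
∣p∣>0 {p = p} (x , x∈p) = subst (_≤ ∣ p ∣) (∣⁅x⁆∣≡1 x)
  (p⊆q⇒∣p∣≤∣q∣ (λ y∈⁅x⁆ → subst (_∈ p) (sym (x∈⁅y⁆⇒x≡y x y∈⁅x⁆)) x∈p))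

∃-≤-average : ∀ {n} (p : Subset n) → Nonempty p → (g : Fin n → ℕ) →
              ∃ λ x → x ∈ p × ∣ p ∣ * g x ≤ ∑[ y < n ] (χ p y * g y)
∃-≤-average {n} p p≢∅ g with any? (λ x → x ∈? p ×-dec ∣ p ∣ * g x ≤? ∑[ y < n ] (χ p y * g y))
... | yes found = found
... | no none = contradiction (*-cancelˡ-≤ ∣ p ∣ {{>-nonZero (∣p∣>0 p≢∅)}} (begin
  ∣ p ∣ * suc total                      ≡⟨ cong (_* suc total) (∣p∣≡∑χ p) ⟩
  sum (χ p) * suc total                  ≡⟨ *-distribʳ-sum (suc total) (χ p) ⟩
  ∑[ y < n ] (χ p y * suc total)         ≤⟨ ∑-mono-≤ above-average ⟩
  ∑[ y < n ] (χ p y * (∣ p ∣ * g y))     ≡⟨ sum-cong-≗ (λ y → swap-factors (χ p y) ∣ p ∣ (g y)) ⟩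
  ∑[ y < n ] (∣ p ∣ * (χ p y * g y))     ≡⟨ *-distribˡ-sum ∣ p ∣ (λ y → χ p y * g y) ⟨
  ∣ p ∣ * total                          ∎)) (n≮n total)
  where
  open ≤-Reasoning
  total = ∑[ y < n ] (χ p y * g y)
  above-average : ∀ y → χ p y * suc total ≤ χ p y * (∣ p ∣ * g y)
  above-average y with y ∈? p
  ... | yes y∈p = +-monoˡ-≤ 0 (≰⇒> (λ below → none (y , y∈p , below)))
  ... | no _ = z≤n
  swap-factors : ∀ a b c → a * (b * c) ≡ b * (a * c)
  swap-factors = solve-∀

∑-on-subset-bound : ∀ {n} (p : Subset n) (f : Fin n → ℕ) {c} → (∀ x → c ≤ f x) →
                    ∑[ x < n ] (χ p x * f x) + n * c ≤ sum f + ∣ p ∣ * c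
∑-on-subset-bound {n} p f {c} c≤f = begin
  ∑[ x < n ] (χ p x * f x) + n * c                 ≡⟨ cong (_ +_) (∑-const n c) ⟨
  ∑[ x < n ] (χ p x * f x) + ∑[ x < n ] c          ≡⟨ ∑-distrib-+ (λ x → χ p x * f x) (λ _ → c) ⟨
  ∑[ x < n ] (χ p x * f x + c)                     ≤⟨ ∑-mono-≤ pointwise ⟩
  ∑[ x < n ] (f x + χ p x * c)                     ≡⟨ ∑-distrib-+ f (λ x → χ p x * c) ⟩
  sum f + ∑[ x < n ] (χ p x * c)                   ≡⟨ cong (sum f +_) (*-distribʳ-sum c (χ p)) ⟨
  sum f + sum (χ p) * c                            ≡⟨ cong (λ k → sum f + k * c) (∣p∣≡∑χ p) ⟨
  sum f + ∣ p ∣ * c                                ∎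
  where
  open ≤-Reasoning
  pointwise : ∀ x → χ p x * f x + c ≤ f x + χ p x * c
  pointwise x with x ∈? p
  ... | yes _ = ≤-reflexive (cong₂ _+_ (+-identityʳ (f x)) (sym (+-identityʳ c)))
  ... | no _ = ≤-trans (c≤f x) (m≤m+n (f x) 0)

min-square-bound : ∀ q z L → q * z ≤ L * (z + q * q) → (q * q) ⊓ z ≤ 2 * (q * L)
min-square-bound zero z L _ = z≤n
min-square-bound q@(suc _) zero L _ = subst (_≤ 2 * (q * L)) (sym (⊓-zeroʳ (q * q))) z≤n
min-square-bound q@(suc _) z@(suc _) L qz≤L[z+q²] with ≤-total z (q * q)
... | inj₁ z≤q² = ≤-trans (m⊓n≤n (q * q) z) (*-cancelˡ-≤ q (begin
  q * z                    ≤⟨ qz≤L[z+q²] ⟩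
  L * (z + q * q)          ≤⟨ *-monoʳ-≤ L (+-monoˡ-≤ (q * q) z≤q²) ⟩
  L * (q * q + q * q)      ≡⟨ regroup q L ⟩
  q * (2 * (q * L))        ∎))
  where
  open ≤-Reasoning
  regroup : ∀ q L → L * (q * q + q * q) ≡ q * (2 * (q * L))
  regroup = solve-∀
... | inj₂ q²≤z = ≤-trans (m⊓n≤m (q * q) z) (begin
  q * q                    ≤⟨ *-monoʳ-≤ q (*-cancelʳ-≤ q (2 * L) z (begin
      q * z                ≤⟨ qz≤L[z+q²] ⟩
      L * (z + q * q)      ≤⟨ *-monoʳ-≤ L (+-monoʳ-≤ z q²≤z) ⟩
      L * (z + z)          ≡⟨ regroup z L ⟩
      2 * L * z            ∎)) ⟩
  q * (2 * L)              ≡⟨ regroup′ q L ⟩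
  2 * (q * L)              ∎)
  where
  open ≤-Reasoning
  regroup : ∀ z L → L * (z + z) ≡ 2 * L * z
  regroup = solve-∀
  regroup′ : ∀ q L → q * (2 * L) ≡ 2 * (q * L)
  regroup′ = solve-∀

min-square-bound-from-energy : ∀ m q N L E → m * (q * E) ≤ m * (N * N) + q * q * N → N * N ≤ L * E →
                               (q * q) ⊓ (m * N) ≤ 2 * (q * L)
min-square-bound-from-energy m q zero L E _ _ =
  subst (_≤ 2 * (q * L)) (sym (trans (cong ((q * q) ⊓_) (*-zeroʳ m)) (⊓-zeroʳ (q * q)))) z≤n
min-square-bound-from-energy m q N@(suc _) L E average energy =
  min-square-bound q (m * N) L (*-cancelˡ-≤ N (begin
  N * (q * (m * N))                  ≡⟨ regroup₁ m q N ⟩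
  m * q * (N * N)                    ≤⟨ *-monoʳ-≤ (m * q) energy ⟩
  m * q * (L * E)                    ≡⟨ regroup₂ m q L E ⟩
  L * (m * (q * E))                  ≤⟨ *-monoʳ-≤ L average ⟩
  L * (m * (N * N) + q * q * N)      ≡⟨ regroup₃ m q N L ⟩
  N * (L * (m * N + q * q))          ∎))
  where
  open ≤-Reasoning
  regroup₁ : ∀ m q N → N * (q * (m * N)) ≡ m * q * (N * N)
  regroup₁ = solve-∀
  regroup₂ : ∀ m q L E → m * q * (L * E) ≡ L * (m * (q * E))
  regroup₂ = solve-∀
  regroup₃ : ∀ m q N L → L * (m * (N * N) + q * q * N) ≡ N * (L * (m * N + q * q))
  regroup₃ = solve-∀

module LineGeometry {q : ℕ} (F : FiniteField q) where

  open FiniteField F renaming (_+_ to _+ᶠ_; _*_ to _*ᶠ_)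

  commutativeRing : CommutativeRing _ _
  commutativeRing = record { isCommutativeRing = isCommutativeRing }

  module R = CommutativeRing commutativeRing
  open R using (_-_)
  open RingProperties R.ring using ([y-z]x≈yx-zx; x≈z//y; xyx⁻¹≈y; x∙y⁻¹≈ε⇒x≈y; +-cancelˡ)

  *ᶠ-cancelˡ : ∀ {d y z} → d ≢ 0# → d *ᶠ y ≡ d *ᶠ z → y ≡ z
  *ᶠ-cancelˡ {d} {y} {z} d≢0 dy≡dz with e , de≡1 ← inverse d d≢0 =
    trans (sym (undo y)) (trans (cong (e *ᶠ_) dy≡dz) (undo z))
    where
    open ≡-Reasoning
    undo : ∀ x → e *ᶠ (d *ᶠ x) ≡ x
    undo x = begin
      e *ᶠ (d *ᶠ x)   ≡⟨ R.*-assoc e d x ⟨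
      (e *ᶠ d) *ᶠ x   ≡⟨ cong (_*ᶠ x) (trans (R.*-comm e d) de≡1) ⟩
      1# *ᶠ x         ≡⟨ R.*-identityˡ x ⟩
      x               ∎

  slope-difference : ∀ {a a′ b b′ y} → a *ᶠ y +ᶠ b ≡ a′ *ᶠ y +ᶠ b′ → (a - a′) *ᶠ y ≡ b′ - b
  slope-difference {a} {a′} {b} {b′} {y} meet = begin
    (a - a′) *ᶠ y                       ≡⟨ [y-z]x≈yx-zx y a a′ ⟩
    a *ᶠ y - a′ *ᶠ y                    ≡⟨ cong (_- a′ *ᶠ y) (x≈z//y (a *ᶠ y) b (a′ *ᶠ y +ᶠ b′) meet) ⟩
    (a′ *ᶠ y +ᶠ b′) - b - a′ *ᶠ y       ≡⟨ cong (_- a′ *ᶠ y) (R.+-assoc (a′ *ᶠ y) b′ (- b)) ⟩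
    a′ *ᶠ y +ᶠ (b′ - b) - a′ *ᶠ y       ≡⟨ xyx⁻¹≈y (a′ *ᶠ y) (b′ - b) ⟩
    b′ - b                              ∎
    where open ≡-Reasoning

  lines-meet-at-most-once : ∀ {a a′ b b′ y z} → a ≢ a′ →
    a *ᶠ y +ᶠ b ≡ a′ *ᶠ y +ᶠ b′ → a *ᶠ z +ᶠ b ≡ a′ *ᶠ z +ᶠ b′ → y ≡ z
  lines-meet-at-most-once {a} {a′} a≢a′ meet-y meet-z =
    *ᶠ-cancelˡ (a≢a′ ∘ x∙y⁻¹≈ε⇒x≈y a a′) (trans (slope-difference meet-y) (sym (slope-difference meet-z)))

  parallel-lines-disjoint : ∀ {a b b′ y} → b ≢ b′ → a *ᶠ y +ᶠ b ≢ a *ᶠ y +ᶠ b′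
  parallel-lines-disjoint {a} {b} {b′} {y} b≢b′ = b≢b′ ∘ +-cancelˡ (a *ᶠ y) b b′

  meeting-count≤ : ∀ a b a′ b′ →
                   ∑[ y < q ] ⟦ a′ *ᶠ y +ᶠ b′ ≟ a *ᶠ y +ᶠ b ⟧ ≤ ⟦ a ≟ a′ ⟧ * (⟦ b ≟ b′ ⟧ * q) + 1
  meeting-count≤ a b a′ b′ with a ≟ a′ | b ≟ b′
  ... | no a≢a′ | _ = ∑⟦P⟧≤1 (λ y → a′ *ᶠ y +ᶠ b′ ≟ a *ᶠ y +ᶠ b)
    (λ meet-y meet-z → lines-meet-at-most-once a≢a′ (sym meet-y) (sym meet-z))
  ... | yes refl | no b≢b′ = ≤-trans (≤-reflexive (∑-zero (λ y →
    ⟦⟧-no (a *ᶠ y +ᶠ b′ ≟ a *ᶠ y +ᶠ b) (parallel-lines-disjoint (b≢b′ ∘ sym))))) z≤n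
  ... | yes refl | yes refl = ≤-trans (≤-reflexive (begin
    ∑[ y < q ] ⟦ a *ᶠ y +ᶠ b ≟ a *ᶠ y +ᶠ b ⟧   ≡⟨ sum-cong-≗ (λ y → ⟦⟧-yes (a *ᶠ y +ᶠ b ≟ a *ᶠ y +ᶠ b) refl) ⟩
    ∑[ y < q ] 1                              ≡⟨ ∑-const q 1 ⟩
    q * 1                                     ≡⟨ *-identityʳ q ⟩
    q                                         ≡⟨ trans (*-identityˡ (1 * q)) (*-identityˡ q) ⟨
    1 * (1 * q)                               ∎)) (m≤m+n _ 1)
    where open ≡-Reasoning

  module WeightedLines (ν : Fin q → Fin q → ℕ) where

    multiplicity : Fin q → Fin q → ℕ
    multiplicity y x = ∑₂ (λ a b → ⟦ a *ᶠ y +ᶠ b ≟ x ⟧ * ν a b)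

    energy : Fin q → ℕ
    energy y = ∑[ x < q ] (multiplicity y x * multiplicity y x)

    ∑-multiplicity-weighted : ∀ y (g : Fin q → ℕ) →
                       ∑[ x < q ] (multiplicity y x * g x) ≡ ∑₂ (λ a b → ν a b * g (a *ᶠ y +ᶠ b))
    ∑-multiplicity-weighted y g = begin
      ∑[ x < q ] (multiplicity y x * g x)
        ≡⟨ sum-cong-≗ (λ x → *-distribʳ-∑₂ (g x) (λ a b → ⟦ a *ᶠ y +ᶠ b ≟ x ⟧ * ν a b)) ⟩
      ∑[ x < q ] ∑₂ (λ a b → ⟦ a *ᶠ y +ᶠ b ≟ x ⟧ * ν a b * g x)
        ≡⟨ ∑-∑₂-comm (λ x a b → ⟦ a *ᶠ y +ᶠ b ≟ x ⟧ * ν a b * g x) ⟩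
      ∑₂ (λ a b → ∑[ x < q ] (⟦ a *ᶠ y +ᶠ b ≟ x ⟧ * ν a b * g x))
        ≡⟨ ∑₂-cong (λ a b → sum-cong-≗ (λ x → *-assoc ⟦ a *ᶠ y +ᶠ b ≟ x ⟧ (ν a b) (g x))) ⟩
      ∑₂ (λ a b → ∑[ x < q ] (⟦ a *ᶠ y +ᶠ b ≟ x ⟧ * (ν a b * g x)))
        ≡⟨ ∑₂-cong (λ a b → ∑-select (a *ᶠ y +ᶠ b) (λ x → ν a b * g x)) ⟩
      ∑₂ (λ a b → ν a b * g (a *ᶠ y +ᶠ b)) ∎
      where open ≡-Reasoning

    ∑-multiplicity : ∀ y → ∑[ x < q ] multiplicity y x ≡ ∑₂ ν
    ∑-multiplicity y = begin
      ∑[ x < q ] multiplicity y x          ≡⟨ sum-cong-≗ (λ x → *-identityʳ (multiplicity y x)) ⟨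
      ∑[ x < q ] (multiplicity y x * 1)    ≡⟨ ∑-multiplicity-weighted y (λ _ → 1) ⟩
      ∑₂ (λ a b → ν a b * 1)               ≡⟨ ∑₂-cong (λ a b → *-identityʳ (ν a b)) ⟩
      ∑₂ ν                                 ∎
      where open ≡-Reasoning

    ∑-multiplicity-along-line : ∀ a b → ∑[ y < q ] multiplicity y (a *ᶠ y +ᶠ b) ≤ q * ν a b + ∑₂ ν
    ∑-multiplicity-along-line a b = begin
      ∑[ y < q ] multiplicity y (a *ᶠ y +ᶠ b)
        ≡⟨ ∑-∑₂-comm (λ y a′ b′ → ⟦ a′ *ᶠ y +ᶠ b′ ≟ a *ᶠ y +ᶠ b ⟧ * ν a′ b′) ⟩
      ∑₂ (λ a′ b′ → ∑[ y < q ] (⟦ a′ *ᶠ y +ᶠ b′ ≟ a *ᶠ y +ᶠ b ⟧ * ν a′ b′))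
        ≡⟨ ∑₂-cong (λ a′ b′ → *-distribʳ-sum (ν a′ b′) (λ y → ⟦ a′ *ᶠ y +ᶠ b′ ≟ a *ᶠ y +ᶠ b ⟧)) ⟨
      ∑₂ (λ a′ b′ → ∑[ y < q ] ⟦ a′ *ᶠ y +ᶠ b′ ≟ a *ᶠ y +ᶠ b ⟧ * ν a′ b′)
        ≤⟨ ∑₂-mono-≤ (λ a′ b′ → *-monoˡ-≤ (ν a′ b′) (meeting-count≤ a b a′ b′)) ⟩
      ∑₂ (λ a′ b′ → (⟦ a ≟ a′ ⟧ * (⟦ b ≟ b′ ⟧ * q) + 1) * ν a′ b′)
        ≡⟨ ∑₂-cong (λ a′ b′ → expand q ⟦ a ≟ a′ ⟧ ⟦ b ≟ b′ ⟧ (ν a′ b′)) ⟩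
      ∑₂ (λ a′ b′ → ⟦ a ≟ a′ ⟧ * (⟦ b ≟ b′ ⟧ * (q * ν a′ b′)) + ν a′ b′)
        ≡⟨ ∑₂-distrib-+ (λ a′ b′ → ⟦ a ≟ a′ ⟧ * (⟦ b ≟ b′ ⟧ * (q * ν a′ b′))) ν ⟩
      ∑₂ (λ a′ b′ → ⟦ a ≟ a′ ⟧ * (⟦ b ≟ b′ ⟧ * (q * ν a′ b′))) + ∑₂ ν
        ≡⟨ cong (_+ ∑₂ ν) (∑₂-select a b (λ a′ b′ → q * ν a′ b′)) ⟩
      q * ν a b + ∑₂ ν ∎
      where
      open ≤-Reasoning
      expand : ∀ q s t v → (s * (t * q) + 1) * v ≡ s * (t * (q * v)) + v
      expand = solve-∀

    ∑-energy≤ : ∑[ y < q ] energy y ≤ q * ∑₂ (λ a b → ν a b * ν a b) + ∑₂ ν * ∑₂ ν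
    ∑-energy≤ = begin
      ∑[ y < q ] energy y
        ≡⟨ sum-cong-≗ (λ y → ∑-multiplicity-weighted y (multiplicity y)) ⟩
      ∑[ y < q ] ∑₂ (λ a b → ν a b * multiplicity y (a *ᶠ y +ᶠ b))
        ≡⟨ ∑-∑₂-comm (λ y a b → ν a b * multiplicity y (a *ᶠ y +ᶠ b)) ⟩
      ∑₂ (λ a b → ∑[ y < q ] (ν a b * multiplicity y (a *ᶠ y +ᶠ b)))
        ≡⟨ ∑₂-cong (λ a b → *-distribˡ-sum (ν a b) (λ y → multiplicity y (a *ᶠ y +ᶠ b))) ⟨
      ∑₂ (λ a b → ν a b * ∑[ y < q ] multiplicity y (a *ᶠ y +ᶠ b))
        ≤⟨ ∑₂-mono-≤ (λ a b → *-monoʳ-≤ (ν a b) (∑-multiplicity-along-line a b)) ⟩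
      ∑₂ (λ a b → ν a b * (q * ν a b + ∑₂ ν))
        ≡⟨ ∑₂-cong (λ a b → expand q (ν a b) (∑₂ ν)) ⟩
      ∑₂ (λ a b → q * (ν a b * ν a b) + ν a b * ∑₂ ν)
        ≡⟨ ∑₂-distrib-+ (λ a b → q * (ν a b * ν a b)) (λ a b → ν a b * ∑₂ ν) ⟩
      ∑₂ (λ a b → q * (ν a b * ν a b)) + ∑₂ (λ a b → ν a b * ∑₂ ν)
        ≡⟨ cong₂ _+_ (*-distribˡ-∑₂ q (λ a b → ν a b * ν a b)) (*-distribʳ-∑₂ (∑₂ ν) ν) ⟨
      q * ∑₂ (λ a b → ν a b * ν a b) + ∑₂ ν * ∑₂ ν ∎
      where
      open ≤-Reasoning
      expand : ∀ q v s → v * (q * v + s) ≡ q * (v * v) + v * s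
      expand = solve-∀

  module LinesOver (C : Subset q) where

    χ₂ : Fin q → Fin q → ℕ
    χ₂ a b = χ C a * χ C b

    open WeightedLines χ₂ public

    n : ℕ
    n = ∣ C ∣

    ∑χ₂ : ∑₂ χ₂ ≡ n * n
    ∑χ₂ = trans (sym (∑*∑≡∑₂ (χ C) (χ C))) (sym (cong₂ _*_ (∣p∣≡∑χ C) (∣p∣≡∑χ C)))

    ∑χ₂² : ∑₂ (λ a b → χ₂ a b * χ₂ a b) ≡ n * n
    ∑χ₂² = trans (∑₂-cong (λ a b → ⟦⟧⟦⟧-idem (a ∈? C) (b ∈? C))) ∑χ₂
      where
      ⟦⟧⟦⟧-idem : ∀ {P Q : Set} (P? : Dec P) (Q? : Dec Q) →
                  ⟦ P? ⟧ * ⟦ Q? ⟧ * (⟦ P? ⟧ * ⟦ Q? ⟧) ≡ ⟦ P? ⟧ * ⟦ Q? ⟧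
      ⟦⟧⟦⟧-idem P? Q? = trans (regroup ⟦ P? ⟧ ⟦ Q? ⟧) (cong₂ _*_ (⟦⟧-idem P?) (⟦⟧-idem Q?))
        where
        regroup : ∀ s t → s * t * (s * t) ≡ s * s * (t * t)
        regroup = solve-∀

    ∈-lineImage : ∀ {a b} y → a ∈ C → b ∈ C → a *ᶠ y +ᶠ b ∈ lineImage F C y
    ∈-lineImage {a} {b} y a∈C b∈C = ∈-⋃
      (∈-concatMap⁺ (λ a′ → map (λ b′ → ⁅ a′ *ᶠ y +ᶠ b′ ⁆) (elems C))
        (lose (∈-elems a∈C) (∈-map⁺ (λ b′ → ⁅ a *ᶠ y +ᶠ b′ ⁆) (∈-elems b∈C))))
      (x∈⁅x⁆ (a *ᶠ y +ᶠ b))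

    multiplicity-outside : ∀ y x → x ∉ lineImage F C y → multiplicity y x ≡ 0
    multiplicity-outside y x x∉image = ∑-zero (λ a → ∑-zero (λ b → no-representation a b))
      where
      no-representation : ∀ a b → ⟦ a *ᶠ y +ᶠ b ≟ x ⟧ * χ₂ a b ≡ 0
      no-representation a b with a *ᶠ y +ᶠ b ≟ x | a ∈? C | b ∈? C
      ... | yes ay+b≡x | yes a∈C | yes b∈C =
        contradiction (subst (_∈ lineImage F C y) ay+b≡x (∈-lineImage y a∈C b∈C)) x∉image
      ... | yes _ | yes _ | no _ = refl
      ... | yes _ | no _ | _ = refl
      ... | no _ | _ | _ = refl

    energy-lower-bound : ∀ y → (n * n) * (n * n) ≤ ∣ lineImage F C y ∣ * energy y
    energy-lower-bound y =
      subst (λ s → s * s ≤ ∣ lineImage F C y ∣ * energy y) (trans (∑-multiplicity y) ∑χ₂)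
      (cauchy-schwarz-on-support (lineImage F C y) (multiplicity y) (multiplicity-outside y))

    ∑-energy-on-subset : ∀ (Y : Subset q) →
                         ∑[ y < q ] (χ Y y * (q * energy y)) ≤ ∣ Y ∣ * ((n * n) * (n * n)) + q * q * (n * n)
    ∑-energy-on-subset Y = +-cancelʳ-≤ (q * n⁴) _ _ (begin
      ∑[ y < q ] (χ Y y * (q * energy y)) + q * n⁴  ≤⟨ ∑-on-subset-bound Y (λ y → q * energy y) n⁴≤q*energy ⟩
      ∑[ y < q ] (q * energy y) + ∣ Y ∣ * n⁴          ≡⟨ cong (_+ ∣ Y ∣ * n⁴) (*-distribˡ-sum q energy) ⟨
      q * ∑[ y < q ] energy y + ∣ Y ∣ * n⁴            ≤⟨ +-monoˡ-≤ (∣ Y ∣ * n⁴) (*-monoʳ-≤ q ∑-energy≤) ⟩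
      q * (q * ∑₂ (λ a b → χ₂ a b * χ₂ a b) + ∑₂ χ₂ * ∑₂ χ₂) + ∣ Y ∣ * n⁴
                                                   ≡⟨ cong₂ (λ s t → q * (q * s + t * t) + ∣ Y ∣ * n⁴) ∑χ₂² ∑χ₂ ⟩
      q * (q * (n * n) + n⁴) + ∣ Y ∣ * n⁴             ≡⟨ regroup q (n * n) n⁴ ∣ Y ∣ ⟩
      ∣ Y ∣ * n⁴ + q * q * (n * n) + q * n⁴           ∎)
      where
      open ≤-Reasoning
      n⁴ = (n * n) * (n * n)
      n⁴≤q*energy : ∀ y → n⁴ ≤ q * energy y
      n⁴≤q*energy y = ≤-trans (energy-lower-bound y) (*-monoˡ-≤ (energy y) (∣p∣≤n (lineImage F C y)))
      regroup : ∀ q N c m → q * (q * N + c) + m * c ≡ m * c + q * q * N + q * c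
      regroup = solve-∀

theorem2p5 : Σ ℕ λ N → ∀ (q : ℕ) → IsPrimePower q → (F : FiniteField q)
    → (Y C : Subset q) → FiniteField.0# F ∉ Y → Nonempty Y
    → ∃ λ y → y ∈ Y × ((q * q) ⊓ (∣ Y ∣ * (∣ C ∣ * ∣ C ∣)) ≤ N * (q * ∣ lineImage F C y ∣))
theorem2p5 = 2 , λ q _ F Y C _ Y≢∅ →
  let open LineGeometry.LinesOver F C
      (y , y∈Y , below-average) = ∃-≤-average Y Y≢∅ (λ y → q * energy y)
  in y , y∈Y , min-square-bound-from-energy (∣ Y ∣) q (n * n) (∣ lineImage F C y ∣) (energy y)
                 (≤-trans below-average (∑-energy-on-subset Y)) (energy-lower-bound y)
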